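{- Let $q$ be a prime power and let $q-1=de$ with $d,e$ positive integers. (i) Let $\ell$ be an integer with $0\le \ell\le e$ and $f=x^{e-\ell}$. For any $a,b\in\mathbb{F}_q$ with $a\neq0$, $b\neq 0$, the number of $x\in\mathbb{F}_q$ with $f(x)=ax+b$ is at most $(\ell+1)(q-1)/e$. (ii) Let $m\ge 1$ be an integer and $f=x^{e+m}$. For any $a,b\in\mathbb{F}_q$ with $a\neq 0$, $b\neq 0$, the number of $x\in\mathbb{F}_q$ with $f(x)=ax+b$ is at most $m(q-1)/e$. -}

module Defs where

open import Level using (Level; _⊔_) renaming (suc to lsuc)
open import Algebra.Bundles using (CommutativeRing)
import Algebra.Bundles
import Algebra.Definitions.RawSemiring as RawSemiringDefs
open import Data.Nat using (ℕ; suc; _^_)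
open import Data.Nat.Primality using (Prime)
open import Data.Fin using (Fin)
open import Data.List using (length; filter; allFin)
open import Data.Product using (∃; ∃-syntax; _×_)
open import Relation.Nullary using (¬_; Dec)
open import Relation.Binary.Definitions using (Decidable)
open import Relation.Binary.PropositionalEquality using (_≡_)

IsPrimePower : ℕ → Set
IsPrimePower q = ∃[ p ] ∃[ k ] (Prime p × q ≡ p ^ suc k)

record FiniteField (c ℓ : Level) (q : ℕ) : Set (lsuc (c ⊔ ℓ)) where
  field
    commutativeRing : CommutativeRing c ℓ
  open CommutativeRing commutativeRing public
  open RawSemiringDefs (Algebra.Bundles.Semiring.rawSemiring semiring) public using () renaming (_^_ to _^ᶠ_)
  field
    _≟_             : Decidable _≈_
    0≉1             : ¬ (0# ≈ 1#)
    inverse         : ∀ x → ¬ (x ≈ 0#) → ∃[ y ] (x * y ≈ 1#)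
    enum            : Fin q → Carrier
    enum-injective  : ∀ i j → enum i ≈ enum j → i ≡ j
    enum-surjective : ∀ x → ∃[ i ] (enum i ≈ x)

  count : {p : Level} {P : Carrier → Set p} → (∀ x → Dec (P x)) → ℕ
  count P? = length (filter (λ i → P? (enum i)) (allFin q))

  numSol : ℕ → Carrier → Carrier → ℕ
  numSol n a b = count (λ x → (x ^ᶠ n) ≟ ((a * x) + b))

{-# OPTIONS --safe #-}
module Submission where

-- A solution x of x ^ n = a x + b with n ≥ 1 is nonzero because b ≠ 0, so x ^ (e d) = x ^ (q - 1) = 1
-- by Fermat's little theorem. For n = e - l this gives (x ^ l (a x + b)) ^ d = (x ^ e) ^ d = 1, and for
-- n = e + m it gives (a x + b) ^ d = x ^ ((e + m) d) = x ^ (m d). Hence every solution is a root of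
-- (x ^ l (a x + b)) ^ d - 1, of degree (l + 1) d, respectively of x ^ (m d) - (a x + b) ^ d, of degree m d.
-- Neither polynomial vanishes at the root of a x + b, and a nonzero polynomial over a field has at most
-- as many roots as its degree.

open import Defs
open import Level using (Level; _⊔_)
open import Algebra.Bundles using (CommutativeRing; Semiring)
open import Data.Nat as ℕ using (ℕ; zero; suc; _≤_; _<_; _∸_; z≤n; s≤s; s≤s⁻¹)
open import Data.Nat.Properties as ℕ using (≤-trans; ≤-reflexive; m≤n⇒m≤1+n; m≤n+m)
open import Data.Fin as Fin using (Fin; punchIn)
open import Data.Fin.Properties using (punchInᵢ≢i)
open import Data.Fin.Permutation using (Permutation; permutation; _⟨$⟩ʳ_)
open import Data.List using (List; []; _∷_; length; filter; map; allFin)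
open import Data.List.Relation.Unary.All as All using (All; []; _∷_)
open import Data.List.Relation.Unary.Unique.Propositional.Properties using (allFin⁺)
import Data.List.Relation.Unary.Unique.Setoid.Properties as Unique
open import Data.Product using (∃-syntax; _×_; _,_; proj₁; proj₂; map₁; map₂)
open import Data.Sum using (_⊎_; inj₁; inj₂; [_,_])
open import Data.Bool using (true; false)
open import Data.Vec.Functional using (replicate)
open import Function using (_∘_)
open import Relation.Nullary using (¬_; yes; no; does; contradiction)
open import Relation.Unary using (Pred; Decidable)
import Relation.Binary.Definitions as B
open import Relation.Binary.PropositionalEquality as ≡ using (_≡_; _≢_)

module _ {a p r} {A : Set a} {P : Pred A p} {Q : Pred A r} (P? : Decidable P) (Q? : Decidable Q) where

  length-filter-mono : ∀ {xs} → All (λ x → P x → Q x) xs → length (filter P? xs) ≤ length (filter Q? xs)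
  length-filter-mono []                          = z≤n
  length-filter-mono {x ∷ _} (P⇒Q ∷ P⇒Q-rest) with P? x | Q? x
  ... | yes _  | yes _  = s≤s (length-filter-mono P⇒Q-rest)
  ... | yes px | no ¬qx = contradiction (P⇒Q px) ¬qx
  ... | no _   | yes _  = m≤n⇒m≤1+n (length-filter-mono P⇒Q-rest)
  ... | no _   | no _   = length-filter-mono P⇒Q-rest

module _ {a b p} {A : Set a} {B : Set b} {P : Pred B p} (f : A → B) (P? : Decidable P) where

  length-filter-map : ∀ xs → length (filter P? (map f xs)) ≡ length (filter (P? ∘ f) xs)
  length-filter-map []       = ≡.refl
  length-filter-map (x ∷ xs) with does (P? (f x))
  ... | true  = ≡.cong suc (length-filter-map xs)
  ... | false = length-filter-map xs

module Polynomials {c ℓ} (R : CommutativeRing c ℓ) where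

  open CommutativeRing R
  open import Algebra.Definitions.RawSemiring (Semiring.rawSemiring semiring) using (_^_)
  open import Algebra.Properties.Ring ring using (-0#≈0#; -‿+-comm; -‿distribʳ-*; //-rightDividesˡ; x∙y⁻¹≈ε⇒x≈y)
  open import Algebra.Properties.CommutativeSemigroup +-commutativeSemigroup using (interchange)
  open import Algebra.Properties.CommutativeSemigroup *-commutativeSemigroup using (x∙yz≈y∙xz)
  open import Relation.Binary.Reasoning.Setoid setoid

  -- Degree < n of a polynomial function, expressed through divided differences instead of coefficients:
  -- degree < 0 means f = 0, and degree < n + 1 means that for every r, f x = f r + (x - r) g x for some g
  -- of degree < n. So the factor theorem holds by definition.
  Poly< : ℕ → (Carrier → Carrier) → Set (c ⊔ ℓ)
  Poly< zero    f = ∀ x → f x ≈ 0#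
  Poly< (suc n) f = ∀ r → ∃[ g ] (Poly< n g × ∀ x → f x ≈ f r + (x - r) * g x)

  Poly<-vanishing : ∀ n {f} → (∀ x → f x ≈ 0#) → Poly< n f
  Poly<-vanishing zero    f≈0 = f≈0
  Poly<-vanishing (suc n) {f} f≈0 r = (λ _ → 0#) , Poly<-vanishing n (λ _ → refl) , λ x → begin
    f x                 ≈⟨ f≈0 x ⟩
    0#                  ≈⟨ +-identityʳ 0# ⟨
    0# + 0#             ≈⟨ +-cong (f≈0 r) (zeroʳ (x - r)) ⟨
    f r + (x - r) * 0#  ∎

  Poly<-mono : ∀ {m n f} → m ≤ n → Poly< m f → Poly< n f
  Poly<-mono {n = n} z≤n       f≈0  = Poly<-vanishing n f≈0
  Poly<-mono         (s≤s m≤n) pf r = map₂ (map₁ (Poly<-mono m≤n)) (pf r)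

  Poly<-const : ∀ n k → Poly< (suc n) (λ _ → k)
  Poly<-const n k r = (λ _ → 0#) , Poly<-vanishing n (λ _ → refl) , λ x →
    sym (trans (+-congˡ (zeroʳ (x - r))) (+-identityʳ k))

  Poly<-id : Poly< 2 (λ x → x)
  Poly<-id r = (λ _ → 1#) , Poly<-const 0 1# , λ x → sym (begin
    r + (x - r) * 1#  ≈⟨ +-congˡ (*-identityʳ (x - r)) ⟩
    r + (x - r)       ≈⟨ +-comm r (x - r) ⟩
    (x - r) + r       ≈⟨ //-rightDividesˡ r x ⟩
    x                 ∎)

  Poly<-add : ∀ n {f g} → Poly< n f → Poly< n g → Poly< n (λ x → f x + g x)
  Poly<-add zero    pf pg x = trans (+-cong (pf x) (pg x)) (+-identityʳ 0#)
  Poly<-add (suc n) {f} {g} pf pg r with pf r | pg r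
  ... | f′ , pf′ , f≈ | g′ , pg′ , g≈ = (λ x → f′ x + g′ x) , Poly<-add n pf′ pg′ , λ x → begin
    f x + g x                                        ≈⟨ +-cong (f≈ x) (g≈ x) ⟩
    (f r + (x - r) * f′ x) + (g r + (x - r) * g′ x)  ≈⟨ interchange _ _ _ _ ⟩
    (f r + g r) + ((x - r) * f′ x + (x - r) * g′ x)  ≈⟨ +-congˡ (distribˡ (x - r) _ _) ⟨
    (f r + g r) + (x - r) * (f′ x + g′ x)            ∎

  Poly<-neg : ∀ n {f} → Poly< n f → Poly< n (λ x → - f x)
  Poly<-neg zero    pf x = trans (-‿cong (pf x)) -0#≈0#
  Poly<-neg (suc n) {f} pf r with pf r
  ... | f′ , pf′ , f≈ = (λ x → - f′ x) , Poly<-neg n pf′ , λ x → begin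
    - f x                       ≈⟨ -‿cong (f≈ x) ⟩
    - (f r + (x - r) * f′ x)    ≈⟨ -‿+-comm _ _ ⟨
    - f r + - ((x - r) * f′ x)  ≈⟨ +-congˡ (-‿distribʳ-* (x - r) _) ⟩
    - f r + (x - r) * - f′ x    ∎

  Poly<-sub : ∀ n {f g} → Poly< n f → Poly< n g → Poly< n (λ x → f x - g x)
  Poly<-sub n pf pg = Poly<-add n pf (Poly<-neg n pg)

  Poly<-scale : ∀ n k {f} → Poly< n f → Poly< n (λ x → k * f x)
  Poly<-scale zero    k pf x = trans (*-congˡ (pf x)) (zeroʳ k)
  Poly<-scale (suc n) k {f} pf r with pf r
  ... | f′ , pf′ , f≈ = (λ x → k * f′ x) , Poly<-scale n k pf′ , λ x → begin
    k * f x                         ≈⟨ *-congˡ (f≈ x) ⟩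
    k * (f r + (x - r) * f′ x)      ≈⟨ distribˡ k _ _ ⟩
    k * f r + k * ((x - r) * f′ x)  ≈⟨ +-congˡ (x∙yz≈y∙xz k (x - r) (f′ x)) ⟩
    k * f r + (x - r) * (k * f′ x)  ∎

  -- The product rule for divided differences: f g - f r g r = f r (g - g r) + (f - f r) g.
  Poly<-mul : ∀ m n {f g} → Poly< m f → Poly< (suc n) g → Poly< (m ℕ.+ n) (λ x → f x * g x)
  Poly<-mul zero    n {f} {g} pf pg = Poly<-vanishing n λ x → trans (*-congʳ (pf x)) (zeroˡ (g x))
  Poly<-mul (suc m) n {f} {g} pf pg r with pf r | pg r
  ... | f′ , pf′ , f≈ | g′ , pg′ , g≈ = h , ph , λ x → begin
    f x * g x
      ≈⟨ *-congʳ (f≈ x) ⟩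
    (f r + (x - r) * f′ x) * g x
      ≈⟨ distribʳ (g x) _ _ ⟩
    f r * g x + ((x - r) * f′ x) * g x
      ≈⟨ +-cong (*-congˡ (g≈ x)) (*-assoc _ _ _) ⟩
    f r * (g r + (x - r) * g′ x) + (x - r) * (f′ x * g x)
      ≈⟨ +-congʳ (distribˡ (f r) _ _) ⟩
    (f r * g r + f r * ((x - r) * g′ x)) + (x - r) * (f′ x * g x)
      ≈⟨ +-congʳ (+-congˡ (x∙yz≈y∙xz (f r) (x - r) (g′ x))) ⟩
    (f r * g r + (x - r) * (f r * g′ x)) + (x - r) * (f′ x * g x)
      ≈⟨ +-assoc _ _ _ ⟩
    f r * g r + ((x - r) * (f r * g′ x) + (x - r) * (f′ x * g x))
      ≈⟨ +-congˡ (distribˡ (x - r) _ _) ⟨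
    f r * g r + (x - r) * h x
      ∎
    where
    h : Carrier → Carrier
    h x = f r * g′ x + f′ x * g x
    ph : Poly< (m ℕ.+ n) h
    ph = Poly<-add (m ℕ.+ n) (Poly<-mono (m≤n+m n m) (Poly<-scale n (f r) pg′)) (Poly<-mul m n pf′ pg)

  Poly<-pow : ∀ n k {f} → Poly< (suc n) f → Poly< (suc (k ℕ.* n)) (λ x → f x ^ k)
  Poly<-pow n zero    pf = Poly<-const 0 1#
  Poly<-pow n (suc k) pf = Poly<-mul (suc n) (k ℕ.* n) pf (Poly<-pow n k pf)

  Poly<-monomial : ∀ k → Poly< (suc k) (λ x → x ^ k)
  Poly<-monomial zero    = Poly<-const 0 1#
  Poly<-monomial (suc k) = Poly<-mul 2 k Poly<-id (Poly<-monomial k)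

  Poly<-linear : ∀ a b → Poly< 2 (λ x → a * x + b)
  Poly<-linear a b = Poly<-add 2 (Poly<-mul 1 1 (Poly<-const 0 a) Poly<-id) (Poly<-const 1 b)

  module Roots (_≟_ : B.Decidable _≈_) (no-zero-divisors : ∀ {x y} → x * y ≈ 0# → x ≈ 0# ⊎ y ≈ 0#) where

    open import Data.List.Relation.Unary.Unique.Setoid setoid using (Unique; []; _∷_)

    roots : (Carrier → Carrier) → List Carrier → List Carrier
    roots f = filter (λ x → f x ≟ 0#)

    roots<degree : ∀ {n f y} → Poly< n f → ¬ f y ≈ 0# → ∀ {xs} → Unique xs → length (roots f xs) < n
    roots<degree {zero}  pf fy≉0 _  = contradiction (pf _) fy≉0
    roots<degree {suc _} pf fy≉0 [] = s≤s z≤n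
    roots<degree {suc _} {f} {y} pf fy≉0 {r ∷ xs} (r≉xs ∷ xs!) with f r ≟ 0#
    ... | no _     = roots<degree pf fy≉0 xs!
    ... | yes fr≈0 with pf r
    ...   | g , pg , f≈ =
      s≤s (≤-trans (s≤s (length-filter-mono _ _ (All.map root⇒g-root r≉xs))) (roots<degree pg gy≉0 xs!))
      where
      f≈[x-r]g : ∀ x → f x ≈ (x - r) * g x
      f≈[x-r]g x = trans (f≈ x) (trans (+-congʳ fr≈0) (+-identityˡ _))
      gy≉0 : ¬ g y ≈ 0#
      gy≉0 gy≈0 = fy≉0 (trans (f≈[x-r]g y) (trans (*-congˡ gy≈0) (zeroʳ _)))
      root⇒g-root : ∀ {x} → ¬ r ≈ x → f x ≈ 0# → g x ≈ 0#
      root⇒g-root {x} r≉x fx≈0 with no-zero-divisors (trans (sym (f≈[x-r]g x)) fx≈0)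
      ... | inj₁ x-r≈0 = contradiction (sym (x∙y⁻¹≈ε⇒x≈y x r x-r≈0)) r≉x
      ... | inj₂ gx≈0  = gx≈0

module FiniteFieldProperties {c ℓ q} (F : FiniteField c ℓ q) where

  open FiniteField F
  open Polynomials commutativeRing
  open import Algebra.Properties.Ring ring using (x∙y⁻¹≈ε⇒x≈y; x≈y⇒x∙y⁻¹≈ε; -‿distribʳ-*)
  open import Algebra.Properties.Semiring.Exp semiring using (^-congˡ; ^-homo-*; ^-assocʳ)
  open import Algebra.Properties.CommutativeSemigroup *-commutativeSemigroup using (x∙yz≈y∙xz)
  open import Algebra.Properties.CommutativeMonoid.Sum *-commutativeMonoid
    using () renaming (sum to ∏; sum-remove to ∏-remove; sum-permute to ∏-permute;
                       ∑-distrib-+ to ∏-distrib-*; sum-cong-≋ to ∏-cong; sum-replicate to ∏-replicate)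
  open import Data.List.Relation.Unary.Unique.Setoid setoid using (Unique)
  open import Relation.Binary.Reasoning.Setoid setoid

  x*[x⁻¹*y]≈y : ∀ {x} (x≉0 : ¬ x ≈ 0#) y → x * (proj₁ (inverse x x≉0) * y) ≈ y
  x*[x⁻¹*y]≈y {x} x≉0 y = begin
    x * (x⁻¹ * y)  ≈⟨ *-assoc x x⁻¹ y ⟨
    (x * x⁻¹) * y  ≈⟨ *-congʳ (proj₂ (inverse x x≉0)) ⟩
    1# * y         ≈⟨ *-identityˡ y ⟩
    y              ∎
    where
    x⁻¹ : Carrier
    x⁻¹ = proj₁ (inverse x x≉0)

  *-cancelˡ-nonzero : ∀ {x y z} → ¬ x ≈ 0# → x * y ≈ x * z → y ≈ z
  *-cancelˡ-nonzero {x} {y} {z} x≉0 xy≈xz = begin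
    y              ≈⟨ x*[x⁻¹*y]≈y x≉0 y ⟨
    x * (x⁻¹ * y)  ≈⟨ x∙yz≈y∙xz x x⁻¹ y ⟩
    x⁻¹ * (x * y)  ≈⟨ *-congˡ xy≈xz ⟩
    x⁻¹ * (x * z)  ≈⟨ x∙yz≈y∙xz x⁻¹ x z ⟩
    x * (x⁻¹ * z)  ≈⟨ x*[x⁻¹*y]≈y x≉0 z ⟩
    z              ∎
    where
    x⁻¹ : Carrier
    x⁻¹ = proj₁ (inverse x x≉0)

  no-zero-divisors : ∀ {x y} → x * y ≈ 0# → x ≈ 0# ⊎ y ≈ 0#
  no-zero-divisors {x} {y} xy≈0 with x ≟ 0#
  ... | yes x≈0 = inj₁ x≈0
  ... | no  x≉0 = inj₂ (*-cancelˡ-nonzero x≉0 (trans xy≈0 (sym (zeroʳ x))))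

  open Roots _≟_ no-zero-divisors

  *-nonzero : ∀ {x y} → ¬ x ≈ 0# → ¬ y ≈ 0# → ¬ x * y ≈ 0#
  *-nonzero x≉0 y≉0 = [ x≉0 , y≉0 ] ∘ no-zero-divisors

  ^-nonzero : ∀ {x} n → ¬ x ≈ 0# → ¬ x ^ᶠ n ≈ 0#
  ^-nonzero zero    x≉0 = 0≉1 ∘ sym
  ^-nonzero (suc n) x≉0 = *-nonzero x≉0 (^-nonzero n x≉0)

  ∏-nonzero : ∀ {n} (t : Fin n → Carrier) → (∀ i → ¬ t i ≈ 0#) → ¬ ∏ t ≈ 0#
  ∏-nonzero {zero}  t t≉0 = 0≉1 ∘ sym
  ∏-nonzero {suc n} t t≉0 = *-nonzero (t≉0 Fin.zero) (∏-nonzero (t ∘ Fin.suc) (t≉0 ∘ Fin.suc))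

  0^n≈0 : ∀ {n} → 1 ≤ n → 0# ^ᶠ n ≈ 0#
  0^n≈0 {suc _} _ = zeroˡ _

  ∏-replicate-except-at : ∀ {n x} (t : Fin n → Carrier) (i₀ : Fin n) →
                          t i₀ ≈ 1# → (∀ j → j ≢ i₀ → t j ≈ x) → ∏ t ≈ x ^ᶠ (n ∸ 1)
  ∏-replicate-except-at {suc n} {x} t i₀ tᵢ₀≈1 t≈x = begin
    ∏ t                        ≈⟨ ∏-remove {i = i₀} t ⟩
    t i₀ * ∏ (t ∘ punchIn i₀)  ≈⟨ *-cong tᵢ₀≈1 (∏-cong (λ j → t≈x _ (punchInᵢ≢i i₀ j))) ⟩
    1# * ∏ (replicate n x)     ≈⟨ *-identityˡ _ ⟩
    ∏ (replicate n x)          ≈⟨ ∏-replicate n ⟩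
    x ^ᶠ n                     ∎

  index : Carrier → Fin q
  index y = proj₁ (enum-surjective y)

  enum-index : ∀ y → enum (index y) ≈ y
  enum-index y = proj₂ (enum-surjective y)

  enum-unique : Unique (map enum (allFin q))
  enum-unique = Unique.map⁺ (≡.setoid (Fin q)) setoid (enum-injective _ _) (allFin⁺ q)

  scaling : ∀ {x} → ¬ x ≈ 0# → Permutation q q
  scaling {x} x≉0 = permutation σ τ στ τσ
    where
    σ τ : Fin q → Fin q
    σ i = index (x * enum i)
    τ i = index (proj₁ (inverse x x≉0) * enum i)
    στ : ∀ i → σ (τ i) ≡ i
    στ i = enum-injective _ _ (trans (enum-index _) (trans (*-congˡ (enum-index _)) (x*[x⁻¹*y]≈y x≉0 _)))
    σ-injective : ∀ {i j} → σ i ≡ σ j → i ≡ j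
    σ-injective {i} {j} σi≡σj = enum-injective i j (*-cancelˡ-nonzero x≉0 (begin
      x * enum i  ≈⟨ enum-index _ ⟨
      enum (σ i)  ≡⟨ ≡.cong enum σi≡σj ⟩
      enum (σ j)  ≈⟨ enum-index _ ⟩
      x * enum j  ∎))
    τσ : ∀ i → τ (σ i) ≡ i
    τσ i = σ-injective (στ (σ i))

  nonzeroOr1 : Carrier → Carrier
  nonzeroOr1 y with y ≟ 0#
  ... | yes _ = 1#
  ... | no  _ = y

  nonzeroOr1-cong : ∀ {y z} → y ≈ z → nonzeroOr1 y ≈ nonzeroOr1 z
  nonzeroOr1-cong {y} {z} y≈z with y ≟ 0# | z ≟ 0#
  ... | yes _   | yes _   = refl
  ... | yes y≈0 | no  z≉0 = contradiction (trans (sym y≈z) y≈0) z≉0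
  ... | no  y≉0 | yes z≈0 = contradiction (trans y≈z z≈0) y≉0
  ... | no  _   | no  _   = y≈z

  nonzeroOr1-nonzero : ∀ y → ¬ nonzeroOr1 y ≈ 0#
  nonzeroOr1-nonzero y with y ≟ 0#
  ... | yes _   = 0≉1 ∘ sym
  ... | no  y≉0 = y≉0

  -- Fermat: y ↦ x y permutes F and fixes 0, so it leaves the product of nonzeroOr1 over F unchanged,
  -- while it multiplies each of the q - 1 factors at nonzero y by x.
  module _ {x} (x≉0 : ¬ x ≈ 0#) where

    xOr1 : Carrier → Carrier
    xOr1 y with y ≟ 0#
    ... | yes _ = 1#
    ... | no  _ = x

    nonzeroOr1-* : ∀ y → nonzeroOr1 (x * y) ≈ xOr1 y * nonzeroOr1 y
    nonzeroOr1-* y with y ≟ 0# | (x * y) ≟ 0#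
    ... | yes _   | yes _    = sym (*-identityˡ 1#)
    ... | yes y≈0 | no  xy≉0 = contradiction (trans (*-congˡ y≈0) (zeroʳ x)) xy≉0
    ... | no  y≉0 | yes xy≈0 = contradiction xy≈0 (*-nonzero x≉0 y≉0)
    ... | no  _   | no  _    = refl

    ∏-xOr1 : ∏ (xOr1 ∘ enum) ≈ x ^ᶠ (q ∸ 1)
    ∏-xOr1 = ∏-replicate-except-at (xOr1 ∘ enum) (index 0#) at-0 off-0
      where
      at-0 : xOr1 (enum (index 0#)) ≈ 1#
      at-0 with enum (index 0#) ≟ 0#
      ... | yes _ = refl
      ... | no ≉0 = contradiction (enum-index 0#) ≉0
      off-0 : ∀ j → j ≢ index 0# → xOr1 (enum j) ≈ x
      off-0 j j≢index0 with enum j ≟ 0#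
      ... | yes ≈0 = contradiction (enum-injective _ _ (trans ≈0 (sym (enum-index 0#)))) j≢index0
      ... | no _   = refl

    fermat : x ^ᶠ (q ∸ 1) ≈ 1#
    fermat = *-cancelˡ-nonzero P≉0 (begin
      P * x ^ᶠ (q ∸ 1)
        ≈⟨ *-congˡ ∏-xOr1 ⟨
      P * ∏ (xOr1 ∘ enum)
        ≈⟨ *-comm _ _ ⟩
      ∏ (xOr1 ∘ enum) * P
        ≈⟨ ∏-distrib-* (xOr1 ∘ enum) (nonzeroOr1 ∘ enum) ⟨
      ∏ (λ i → xOr1 (enum i) * nonzeroOr1 (enum i))
        ≈⟨ ∏-cong (λ i → nonzeroOr1-* (enum i)) ⟨
      ∏ (λ i → nonzeroOr1 (x * enum i))
        ≈⟨ ∏-cong (λ i → nonzeroOr1-cong (enum-index (x * enum i))) ⟨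
      ∏ (nonzeroOr1 ∘ enum ∘ (scaling x≉0 ⟨$⟩ʳ_))
        ≈⟨ ∏-permute (nonzeroOr1 ∘ enum) (scaling x≉0) ⟨
      P
        ≈⟨ *-identityʳ P ⟨
      P * 1#
        ∎)
      where
      P : Carrier
      P = ∏ (nonzeroOr1 ∘ enum)
      P≉0 : ¬ P ≈ 0#
      P≉0 = ∏-nonzero (nonzeroOr1 ∘ enum) (nonzeroOr1-nonzero ∘ enum)

  numSol≤degree : ∀ {n a b N f y} → Poly< (suc N) f → ¬ f y ≈ 0# →
                  (∀ x → x ^ᶠ n ≈ a * x + b → f x ≈ 0#) → numSol n a b ≤ N
  numSol≤degree {f = f} pf fy≉0 solution⇒root =
    ≤-trans (length-filter-mono _ _ (All.universal (solution⇒root ∘ enum) (allFin q)))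
    (≤-trans (≤-reflexive (≡.sym (length-filter-map enum (λ x → f x ≟ 0#) (allFin q))))
    (s≤s⁻¹ (roots<degree pf fy≉0 enum-unique)))

  linear-root : ∀ {a b} → ¬ a ≈ 0# → ∃[ y ] a * y + b ≈ 0#
  linear-root {a} {b} a≉0 = - (a⁻¹ * b) , (begin
    a * - (a⁻¹ * b) + b    ≈⟨ +-congʳ (-‿distribʳ-* a (a⁻¹ * b)) ⟨
    - (a * (a⁻¹ * b)) + b  ≈⟨ +-congʳ (-‿cong (x*[x⁻¹*y]≈y a≉0 b)) ⟩
    - b + b                ≈⟨ -‿inverseˡ b ⟩
    0#                     ∎)
    where
    a⁻¹ : Carrier
    a⁻¹ = proj₁ (inverse a a≉0)

  linear-at-0 : ∀ {a b x} → x ≈ 0# → a * x + b ≈ b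
  linear-at-0 {a} {b} x≈0 = trans (+-congʳ (trans (*-congˡ x≈0) (zeroʳ a))) (+-identityˡ b)

  solution-nonzero : ∀ {n a b x} → 1 ≤ n → ¬ b ≈ 0# → x ^ᶠ n ≈ a * x + b → ¬ x ≈ 0#
  solution-nonzero {n} {a} {b} {x} n≥1 b≉0 x^n≈ax+b x≈0 = b≉0 (begin
    b          ≈⟨ linear-at-0 x≈0 ⟨
    a * x + b  ≈⟨ x^n≈ax+b ⟨
    x ^ᶠ n     ≈⟨ ^-congˡ n x≈0 ⟩
    0# ^ᶠ n    ≈⟨ 0^n≈0 n≥1 ⟩
    0#         ∎)

  u≈0⇒u-1≉0 : ∀ {u} → u ≈ 0# → ¬ u - 1# ≈ 0#
  u≈0⇒u-1≉0 {u} u≈0 u-1≈0 = 0≉1 (trans (sym u≈0) (x∙y⁻¹≈ε⇒x≈y u 1# u-1≈0))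

  numSol[0]≤1 : ∀ {a b} → ¬ a ≈ 0# → numSol 0 a b ≤ 1
  numSol[0]≤1 {a} {b} a≉0 =
    numSol≤degree {n = 0} (Poly<-sub 2 (Poly<-linear a b) (Poly<-const 1 1#))
      (u≈0⇒u-1≉0 (proj₂ (linear-root a≉0))) (λ x 1≈ax+b → x≈y⇒x∙y⁻¹≈ε (sym 1≈ax+b))

  module _ (d e : ℕ) (d≥1 : 1 ≤ d) (q∸1≡d*e : q ∸ 1 ≡ d ℕ.* e) where

    [x^e]^d≈1 : ∀ {x} → ¬ x ≈ 0# → (x ^ᶠ e) ^ᶠ d ≈ 1#
    [x^e]^d≈1 {x} x≉0 = begin
      (x ^ᶠ e) ^ᶠ d   ≈⟨ ^-assocʳ x e d ⟩
      x ^ᶠ (e ℕ.* d)  ≡⟨ ≡.cong (x ^ᶠ_) (≡.trans (ℕ.*-comm e d) (≡.sym q∸1≡d*e)) ⟩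
      x ^ᶠ (q ∸ 1)    ≈⟨ fermat x≉0 ⟩
      1#              ∎

    -- For n = 0 the solution x = 0 is possible, so the equation is treated as a x + b = 1 instead.
    numSol≤[l+1]*d : ∀ n l {a b} → l ℕ.+ n ≡ e → ¬ a ≈ 0# → ¬ b ≈ 0# → numSol n a b ≤ (l ℕ.+ 1) ℕ.* d
    numSol≤[l+1]*d zero    l _ a≉0 _ = ≤-trans (numSol[0]≤1 a≉0) (ℕ.*-mono-≤ (m≤n+m 1 l) d≥1)
    numSol≤[l+1]*d (suc k) l {a} {b} l+n≡e a≉0 b≉0 =
      ≤-trans (numSol≤degree {n = suc k} pf (u≈0⇒u-1≉0 fy₀≈0) solution⇒root)
              (≤-reflexive (ℕ.*-comm d (l ℕ.+ 1)))
      where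
      f : Carrier → Carrier
      f x = (x ^ᶠ l * (a * x + b)) ^ᶠ d - 1#
      pf : Poly< (suc (d ℕ.* (l ℕ.+ 1))) f
      pf = Poly<-sub (suc (d ℕ.* (l ℕ.+ 1)))
             (Poly<-pow (l ℕ.+ 1) d (Poly<-mul (suc l) 1 (Poly<-monomial l) (Poly<-linear a b)))
             (Poly<-const (d ℕ.* (l ℕ.+ 1)) 1#)
      y₀ : Carrier
      y₀ = proj₁ (linear-root {b = b} a≉0)
      fy₀≈0 : (y₀ ^ᶠ l * (a * y₀ + b)) ^ᶠ d ≈ 0#
      fy₀≈0 = begin
        (y₀ ^ᶠ l * (a * y₀ + b)) ^ᶠ d  ≈⟨ ^-congˡ d (*-congˡ (proj₂ (linear-root a≉0))) ⟩
        (y₀ ^ᶠ l * 0#) ^ᶠ d            ≈⟨ ^-congˡ d (zeroʳ _) ⟩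
        0# ^ᶠ d                        ≈⟨ 0^n≈0 d≥1 ⟩
        0#                             ∎
      solution⇒root : ∀ x → x ^ᶠ suc k ≈ a * x + b → f x ≈ 0#
      solution⇒root x x^n≈ax+b = x≈y⇒x∙y⁻¹≈ε (begin
        (x ^ᶠ l * (a * x + b)) ^ᶠ d  ≈⟨ ^-congˡ d (*-congˡ x^n≈ax+b) ⟨
        (x ^ᶠ l * x ^ᶠ suc k) ^ᶠ d   ≈⟨ ^-congˡ d (^-homo-* x l (suc k)) ⟨
        (x ^ᶠ (l ℕ.+ suc k)) ^ᶠ d    ≡⟨ ≡.cong (λ n → (x ^ᶠ n) ^ᶠ d) l+n≡e ⟩
        (x ^ᶠ e) ^ᶠ d                ≈⟨ [x^e]^d≈1 (solution-nonzero {n = suc k} (s≤s z≤n) b≉0 x^n≈ax+b) ⟩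
        1#                           ∎)

    numSol[e+m]≤m*d : ∀ {m a b} → 1 ≤ m → ¬ a ≈ 0# → ¬ b ≈ 0# → numSol (e ℕ.+ m) a b ≤ m ℕ.* d
    numSol[e+m]≤m*d {m} {a} {b} m≥1 a≉0 b≉0 = numSol≤degree {n = e ℕ.+ m} pf fy₀≉0 solution⇒root
      where
      f : Carrier → Carrier
      f x = x ^ᶠ (m ℕ.* d) - (a * x + b) ^ᶠ d
      pf : Poly< (suc (m ℕ.* d)) f
      pf = Poly<-sub (suc (m ℕ.* d)) (Poly<-monomial (m ℕ.* d))
             (Poly<-mono (s≤s (≤-trans (≤-reflexive (ℕ.*-comm d 1)) (ℕ.*-monoˡ-≤ d m≥1)))
                         (Poly<-pow 1 d (Poly<-linear a b)))
      y₀ : Carrier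
      y₀ = proj₁ (linear-root {b = b} a≉0)
      ay₀+b≈0 : a * y₀ + b ≈ 0#
      ay₀+b≈0 = proj₂ (linear-root a≉0)
      y₀≉0 : ¬ y₀ ≈ 0#
      y₀≉0 y₀≈0 = b≉0 (trans (sym (linear-at-0 y₀≈0)) ay₀+b≈0)
      fy₀≉0 : ¬ f y₀ ≈ 0#
      fy₀≉0 fy₀≈0 = ^-nonzero (m ℕ.* d) y₀≉0 (begin
        y₀ ^ᶠ (m ℕ.* d)    ≈⟨ x∙y⁻¹≈ε⇒x≈y _ _ fy₀≈0 ⟩
        (a * y₀ + b) ^ᶠ d  ≈⟨ ^-congˡ d ay₀+b≈0 ⟩
        0# ^ᶠ d            ≈⟨ 0^n≈0 d≥1 ⟩
        0#                 ∎)
      solution⇒root : ∀ x → x ^ᶠ (e ℕ.+ m) ≈ a * x + b → f x ≈ 0#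
      solution⇒root x x^[e+m]≈ax+b = x≈y⇒x∙y⁻¹≈ε (sym (begin
        (a * x + b) ^ᶠ d                 ≈⟨ ^-congˡ d x^[e+m]≈ax+b ⟨
        (x ^ᶠ (e ℕ.+ m)) ^ᶠ d            ≈⟨ ^-assocʳ x (e ℕ.+ m) d ⟩
        x ^ᶠ ((e ℕ.+ m) ℕ.* d)           ≡⟨ ≡.cong (x ^ᶠ_) (ℕ.*-distribʳ-+ d e m) ⟩
        x ^ᶠ (e ℕ.* d ℕ.+ m ℕ.* d)       ≈⟨ ^-homo-* x (e ℕ.* d) (m ℕ.* d) ⟩
        x ^ᶠ (e ℕ.* d) * x ^ᶠ (m ℕ.* d)  ≈⟨ *-congʳ (trans (sym (^-assocʳ x e d)) ([x^e]^d≈1 x≉0)) ⟩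
        1# * x ^ᶠ (m ℕ.* d)              ≈⟨ *-identityˡ _ ⟩
        x ^ᶠ (m ℕ.* d)                   ∎))
        where
        x≉0 : ¬ x ≈ 0#
        x≉0 = solution-nonzero (≤-trans m≥1 (m≤n+m m e)) b≉0 x^[e+m]≈ax+b

open import Data.Nat using (_+_; _*_; _≥_; _/_; NonZero)
open import Data.Nat.DivMod using (m*n/n≡m)

[k*n]/e≡k*d : ∀ {n d e} .{{_ : NonZero e}} → n ≡ d * e → ∀ k → (k * n) / e ≡ k * d
[k*n]/e≡k*d {n} {d} {e} n≡d*e k = begin
  (k * n) / e        ≡⟨ ≡.cong (λ n → (k * n) / e) n≡d*e ⟩
  (k * (d * e)) / e  ≡⟨ ≡.cong (_/ e) (ℕ.*-assoc k d e) ⟨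
  (k * d * e) / e    ≡⟨ m*n/n≡m (k * d) e ⟩
  k * d              ∎
  where open ≡.≡-Reasoning

theorem3p17 : ∀ {c ℓ : Level} (q : ℕ) (F : FiniteField c ℓ q) → IsPrimePower q →
    (d e : ℕ) → d ≥ 1 → e ≥ 1 → .{{_ : NonZero e}} → q ∸ 1 ≡ d * e →
    (∀ (l : ℕ) → l ≤ e → ∀ (a b : FiniteField.Carrier F) → ¬ (FiniteField._≈_ F a (FiniteField.0# F)) → ¬ (FiniteField._≈_ F b (FiniteField.0# F)) →
      FiniteField.numSol F (e ∸ l) a b ≤ ((l + 1) * (q ∸ 1)) / e)
    ×
    (∀ (m : ℕ) → m ≥ 1 → ∀ (a b : FiniteField.Carrier F) → ¬ (FiniteField._≈_ F a (FiniteField.0# F)) → ¬ (FiniteField._≈_ F b (FiniteField.0# F)) →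
      FiniteField.numSol F (e + m) a b ≤ (m * (q ∸ 1)) / e)
theorem3p17 q F _ d e d≥1 _ q∸1≡d*e =
  (λ l l≤e a b a≉0 b≉0 →
     ≤-trans (numSol≤[l+1]*d d e d≥1 q∸1≡d*e (e ∸ l) l (ℕ.m+[n∸m]≡n l≤e) a≉0 b≉0)
             (≤-reflexive (≡.sym ([k*n]/e≡k*d q∸1≡d*e (l + 1))))) ,
  (λ m m≥1 a b a≉0 b≉0 →
     ≤-trans (numSol[e+m]≤m*d d e d≥1 q∸1≡d*e m≥1 a≉0 b≉0)
             (≤-reflexive (≡.sym ([k*n]/e≡k*d q∸1≡d*e m))))
  where open FiniteFieldProperties F
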